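{- Let $p$ be a prime power, $m,d\ge 1$, and let $A$ be a check matrix (over $GF(p)$) of a linear MDS code $C\subseteq GF(p)^d$ of code distance $t+1$. Let $V=(GF(p))^m$, regard elements of $V^d$ as $d\times m$ matrices over $GF(p)$, and let $M=\{Y\in V^d: AY=\bar 0\}$. Let $W$ be a linear subspace of $V$, let $M|_W=\{Y\in W^d: AY=\bar 0\}$, and let $u=(u_1,\dots,u_d)\in M$. Then $M_{u,W}=u+M|_{W}$ is an MDS code with code distance $t+1$ in $(u_1+W)\times\dots\times(u_d+W)$ (and hence an MDS subcode of $M$).
   Context: Hamming distance on tuples is the number of differing coordinates. For finite sets $A_1,\dots,A_d$ of equal size $r$, a subset $T\subseteq A_1\times\dots\times A_d$ is an MDS code with code distance $t+1$ if $|T\cap\Gamma|=1$ for every $t$-dimensional axis-aligned plane $\Gamma$ (fix $d-t$ coordinates, let the other $t$ range freely over their alphabets); equivalently it has minimum distance $t+1$ and $r^{d-t}$ elements. A check matrix of a linear code $C$ is a matrix $A$ with $C=\{x: Ax=\bar 0\}$. An MDS subcode of an MDS code $M$ is a set $T=M\cap(A_1\times\dots\times A_d)$ which is an MDS code in $A_1\times\dots\times A_d$ with the same code distance as $M$. -}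

module Defs where

open import Level using (Level; _⊔_)
open import Data.Nat using (ℕ; suc; _^_)
open import Data.Nat.Primality using (Prime)
open import Data.Fin using (Fin)
open import Data.Fin.Subset using (Subset; _∈_; _∉_; ∣_∣)
open import Data.Product using (Σ; ∃; _×_)
open import Relation.Binary.PropositionalEquality using (_≡_)
open import Relation.Nullary using (¬_)
open import Algebra.Bundles using (CommutativeRing)
import Algebra.Definitions.RawMonoid as RM

IsPrimePower : ℕ → Set
IsPrimePower n = Σ ℕ λ q → Σ ℕ λ k → Prime q × n ≡ q ^ suc k

IsField : ∀ {c ℓ} → CommutativeRing c ℓ → Set (c ⊔ ℓ)
IsField R = ¬ (0# ≈ 1#) × (∀ x → ¬ (x ≈ 0#) → ∃ λ y → x * y ≈ 1#)
  where open CommutativeRing R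

HasSize : ∀ {c ℓ} → CommutativeRing c ℓ → ℕ → Set (c ⊔ ℓ)
HasSize R n = Σ (Fin n → Carrier) λ e →
  (∀ i j → e i ≈ e j → i ≡ j) × (∀ x → ∃ λ i → e i ≈ x)
  where open CommutativeRing R

IsGF : ∀ {c ℓ} → CommutativeRing c ℓ → ℕ → Set (c ⊔ ℓ)
IsGF R p = IsField R × HasSize R p

module LinAlg {c ℓ} (R : CommutativeRing c ℓ) where
  open CommutativeRing R
  open RM +-rawMonoid using (sum)

  Vec : ℕ → Set c
  Vec m = Fin m → Carrier

  _≈ᵥ_ : ∀ {m} → Vec m → Vec m → Set ℓ
  x ≈ᵥ y = ∀ i → x i ≈ y i

  _+ᵥ_ : ∀ {m} → Vec m → Vec m → Vec m
  (x +ᵥ y) i = x i + y i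

  _-ᵥ_ : ∀ {m} → Vec m → Vec m → Vec m
  (x -ᵥ y) i = x i - y i

  _·ᵥ_ : ∀ {m} → Carrier → Vec m → Vec m
  (a ·ᵥ x) i = a * x i

  0ᵥ : ∀ {m} → Vec m
  0ᵥ i = 0#

  record IsSubspace {m : ℕ} (W : Vec m → Set ℓ) : Set (c ⊔ ℓ) where
    field
      resp  : ∀ {x y} → x ≈ᵥ y → W x → W y
      zero∈ : W 0ᵥ
      +∈    : ∀ {x y} → W x → W y → W (x +ᵥ y)
      ·∈    : ∀ a {x} → W x → W (a ·ᵥ x)

  Mat : ℕ → ℕ → Set c
  Mat r d = Fin r → Fin d → Carrier

  CheckZero : ∀ {r d} → Mat r d → Vec d → Set ℓ
  CheckZero A x = ∀ k → sum (λ j → A k j * x j) ≈ 0#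

  CheckZeroMat : ∀ {r d m} → Mat r d → (Fin d → Vec m) → Set ℓ
  CheckZeroMat A Y = ∀ k l → sum (λ j → A k j * Y j l) ≈ 0#

-- Alph i is the alphabet A_i (a subset of S), T a subset of the
-- product.  A t-dimensional axis-aligned plane is given by a set I of t
-- free coordinates and values a j ∈ A_j for the fixed coordinates j ∉ I.
-- T is an MDS code with code distance t+1 in A_1 × … × A_d iff every such
-- plane meets T in exactly one element (unique up to ≈ coordinatewise).

InProduct : ∀ {s a d} {S : Set s} → (Fin d → S → Set a) → (Fin d → S) → Set a
InProduct Alph x = ∀ i → Alph i (x i)

InPlane : ∀ {s e d} {S : Set s} (_≈_ : S → S → Set e) →
          Subset d → (Fin d → S) → (Fin d → S) → Set e
InPlane _≈_ I a x = ∀ j → j ∉ I → x j ≈ a j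

IsMDS : ∀ {s e a b} {S : Set s} (_≈_ : S → S → Set e) (d t : ℕ) →
        (Fin d → S → Set a) → ((Fin d → S) → Set b) → Set (s ⊔ e ⊔ a ⊔ b)
IsMDS {S = S} _≈_ d t Alph T =
  (I : Subset d) → ∣ I ∣ ≡ t → (a : Fin d → S) → (∀ j → j ∉ I → Alph j (a j)) →
    (∃ λ x → InProduct Alph x × T x × InPlane _≈_ I a x)
  × (∀ x y → InProduct Alph x × T x × InPlane _≈_ I a x
           → InProduct Alph y × T y × InPlane _≈_ I a y
           → ∀ i → x i ≈ y i)

-- A check matrix A acts on a d × m matrix column by column, so M = {Y : A Y = 0} is C^m
-- and uniqueness in a plane holds column by column. For existence, the MDS property of C
-- gives, for a set I of t free coordinates, codewords e_j that agree with the unit vector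
-- δ_j outside I; then X_i = Σ_j (e_j)_i b_j lies in M|_W whenever every b_j lies in W, and
-- X_i = b_i for i ∉ I. So M|_W is MDS in W^d, and translating by the codeword u carries
-- this over to u + M|_W in (u_1 + W) × … × (u_d + W).
module Submission where

open import Defs
open import Level using (_⊔_; lift)
open import Data.Nat using (ℕ; zero; suc; _≤_)
open import Data.Fin using (Fin; zero; suc; _≟_; punchIn)
open import Data.Fin.Properties using (punchInᵢ≢i)
open import Data.Fin.Subset using (Subset; _∉_; ∣_∣)
open import Data.Fin.Subset.Properties using (_∈?_)
open import Data.Product using (∃; _×_; _,_; proj₁; proj₂)
open import Data.Empty using (⊥-elim)
open import Data.Unit using (⊤; tt)
open import Function.Base using (_∘_)
open import Function.Bundles using (_⇔_; mk⇔)
open import Relation.Nullary using (yes; no)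
open import Relation.Binary.PropositionalEquality using (_≡_; _≢_; refl)
open import Algebra.Bundles using (CommutativeRing)

module _ {c ℓ} (F : CommutativeRing c ℓ) where
  open CommutativeRing F hiding (zero; refl; sym)
  open CommutativeRing F using () renaming (refl to ≈-refl; sym to ≈-sym)
  open LinAlg F
  open import Algebra.Properties.Semiring.Sum semiring
  open import Algebra.Properties.AbelianGroup +-abelianGroup using (x≈z//y; //-rightDividesˡ)
  open import Algebra.Properties.Ring ring using (x[y-z]≈xy-xz)
  open import Relation.Binary.Reasoning.Setoid setoid

  x≈y+z⇒z≈x-y : ∀ {x y z} → x ≈ y + z → z ≈ x - y
  x≈y+z⇒z≈x-y {x} {y} {z} x≈y+z = x≈z//y z y x (trans (+-comm z y) (≈-sym x≈y+z))

  y+[x-y]≈x : ∀ x y → y + (x - y) ≈ x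
  y+[x-y]≈x x y = trans (+-comm y (x - y)) (//-rightDividesˡ y x)

  sum-zero : ∀ {n} (f : Fin n → Carrier) → (∀ j → f j ≈ 0#) → sum f ≈ 0#
  sum-zero {n} f f≈0 = trans (sum-cong-≋ f≈0) (sum-replicate-zero n)

  sum-supportedAt : ∀ {n} (f : Fin (suc n) → Carrier) k → (∀ j → j ≢ k → f j ≈ 0#) → sum f ≈ f k
  sum-supportedAt f k f≈0 = begin
    sum f                           ≈⟨ sum-remove f ⟩
    f k + sum (f ∘ punchIn k)       ≈⟨ +-congˡ (sum-zero _ (λ j → f≈0 _ (punchInᵢ≢i k j))) ⟩
    f k + 0#                        ≈⟨ +-identityʳ (f k) ⟩
    f k                             ∎

  ∑-distrib-‿ : ∀ {n} (f g : Fin n → Carrier) → sum (λ j → f j - g j) ≈ sum f - sum g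
  ∑-distrib-‿ f g = x≈z//y _ (sum g) (sum f) (begin
    sum (λ j → f j - g j) + sum g   ≈⟨ ∑-distrib-+ (λ j → f j - g j) g ⟨
    sum (λ j → f j - g j + g j)     ≈⟨ sum-cong-≋ (λ j → //-rightDividesˡ (g j) (f j)) ⟩
    sum f                           ∎)

  δ : ∀ {d} → Fin d → Fin d → Carrier
  δ i j with i ≟ j
  ... | yes _ = 1#
  ... | no _  = 0#

  δ-diag : ∀ {d} (i : Fin d) → δ i i ≈ 1#
  δ-diag i with i ≟ i
  ... | yes _   = ≈-refl
  ... | no i≢i = ⊥-elim (i≢i refl)

  δ-offDiag : ∀ {d} {i j : Fin d} → i ≢ j → δ i j ≈ 0#
  δ-offDiag {i = i} {j} i≢j with i ≟ j
  ... | yes i≡j = ⊥-elim (i≢j i≡j)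
  ... | no _    = ≈-refl

  sum-δ : ∀ {d} (e : Fin d → Fin d → Carrier) (b : Fin d → Carrier) i →
          (∀ j → e j i ≈ δ j i) → sum (λ j → e j i * b j) ≈ b i
  sum-δ {suc d} e b i e≈δ = begin
    sum (λ j → e j i * b j)  ≈⟨ sum-supportedAt _ i (λ j j≢i → trans (*-congʳ (trans (e≈δ j) (δ-offDiag j≢i))) (zeroˡ (b j))) ⟩
    e i i * b i              ≈⟨ *-congʳ (trans (e≈δ i) (δ-diag i)) ⟩
    1# * b i                 ≈⟨ *-identityˡ (b i) ⟩
    b i                      ∎

  module _ {m} {W : Vec m → Set ℓ} (W-sub : IsSubspace W) where
    open IsSubspace W-sub

    ∈-linearCombination : ∀ {n} (a : Fin n → Carrier) (b : Fin n → Vec m) → (∀ j → W (b j)) →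
                          W (λ l → sum (λ j → a j * b j l))
    ∈-linearCombination {zero}  a b b∈W = zero∈
    ∈-linearCombination {suc n} a b b∈W =
      +∈ (·∈ (a zero) (b∈W zero)) (∈-linearCombination (a ∘ suc) (b ∘ suc) (b∈W ∘ suc))

  module _ {r d} (A : Mat r d) where

    checkZeroMat-resp : ∀ {m} {Y Y′ : Fin d → Vec m} → (∀ j → Y j ≈ᵥ Y′ j) →
                        CheckZeroMat A Y → CheckZeroMat A Y′
    checkZeroMat-resp Y≈Y′ AY≈0 k l = trans (sum-cong-≋ (λ j → *-congˡ (≈-sym (Y≈Y′ j l)))) (AY≈0 k l)

    checkZeroMat-+ : ∀ {m} {Y Z : Fin d → Vec m} → CheckZeroMat A Y → CheckZeroMat A Z →
                     CheckZeroMat A (λ j → Y j +ᵥ Z j)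
    checkZeroMat-+ {Y = Y} {Z} AY≈0 AZ≈0 k l = begin
      sum (λ j → A k j * (Y j l + Z j l))                   ≈⟨ sum-cong-≋ (λ j → distribˡ (A k j) (Y j l) (Z j l)) ⟩
      sum (λ j → A k j * Y j l + A k j * Z j l)             ≈⟨ ∑-distrib-+ (λ j → A k j * Y j l) (λ j → A k j * Z j l) ⟩
      sum (λ j → A k j * Y j l) + sum (λ j → A k j * Z j l) ≈⟨ +-cong (AY≈0 k l) (AZ≈0 k l) ⟩
      0# + 0#                                               ≈⟨ +-identityˡ 0# ⟩
      0#                                                    ∎

    checkZeroMat-‿ : ∀ {m} {Y Z : Fin d → Vec m} → CheckZeroMat A Y → CheckZeroMat A Z →
                     CheckZeroMat A (λ j → Y j -ᵥ Z j)
    checkZeroMat-‿ {Y = Y} {Z} AY≈0 AZ≈0 k l = begin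
      sum (λ j → A k j * (Y j l - Z j l))                   ≈⟨ sum-cong-≋ (λ j → x[y-z]≈xy-xz (A k j) (Y j l) (Z j l)) ⟩
      sum (λ j → A k j * Y j l - A k j * Z j l)             ≈⟨ ∑-distrib-‿ (λ j → A k j * Y j l) (λ j → A k j * Z j l) ⟩
      sum (λ j → A k j * Y j l) - sum (λ j → A k j * Z j l) ≈⟨ +-cong (AY≈0 k l) (-‿cong (AZ≈0 k l)) ⟩
      0# - 0#                                               ≈⟨ -‿inverseʳ 0# ⟩
      0#                                                    ∎

    checkZeroMat-combination : ∀ {m n} (e : Fin n → Vec d) (b : Fin n → Vec m) →
                               (∀ j → CheckZero A (e j)) →
                               CheckZeroMat A (λ i l → sum (λ j → e j i * b j l))
    checkZeroMat-combination e b Ae≈0 k l = begin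
      sum (λ i → A k i * sum (λ j → e j i * b j l))   ≈⟨ sum-cong-≋ (λ i → *-distribˡ-sum (A k i) (λ j → e j i * b j l)) ⟩
      sum (λ i → sum (λ j → A k i * (e j i * b j l))) ≈⟨ sum-cong-≋ (λ i → sum-cong-≋ (λ j → ≈-sym (*-assoc (A k i) (e j i) (b j l)))) ⟩
      sum (λ i → sum (λ j → A k i * e j i * b j l))   ≈⟨ ∑-comm (λ i j → A k i * e j i * b j l) ⟩
      sum (λ j → sum (λ i → A k i * e j i * b j l))   ≈⟨ sum-cong-≋ (λ j → *-distribʳ-sum (b j l) (λ i → A k i * e j i)) ⟨
      sum (λ j → sum (λ i → A k i * e j i) * b j l)   ≈⟨ sum-zero _ (λ j → trans (*-congʳ (Ae≈0 j k)) (zeroˡ (b j l))) ⟩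
      0#                                              ∎

  KernelIn : ∀ {r d m} → (Vec m → Set ℓ) → Mat r d → (Fin d → Vec m) → Set ℓ
  KernelIn W A Y = (∀ j → W (Y j)) × CheckZeroMat A Y

  Coset : ∀ {w m} → (Vec m → Set w) → Vec m → Vec m → Set w
  Coset W x v = W (v -ᵥ x)

  Translate : ∀ {b d m} → (Fin d → Vec m) → ((Fin d → Vec m) → Set b) → (Fin d → Vec m) → Set (c ⊔ ℓ ⊔ b)
  Translate u T Y = ∃ λ Z → T Z × (∀ j → Y j ≈ᵥ (u j +ᵥ Z j))

  -- A plane's values on its free coordinates I are irrelevant and need not lie in W.
  zeroOn : ∀ {d m} → Subset d → (Fin d → Vec m) → Fin d → Vec m
  zeroOn I a j with j ∈? I
  ... | yes _ = 0ᵥ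
  ... | no _  = a j

  zeroOn-∉ : ∀ {d m} I (a : Fin d → Vec m) {j} → j ∉ I → zeroOn I a j ≈ᵥ a j
  zeroOn-∉ I a {j} j∉I with j ∈? I
  ... | yes j∈I = ⊥-elim (j∉I j∈I)
  ... | no _    = λ _ → ≈-refl

  zeroOn-∈ : ∀ {w d m} {W : Vec m → Set w} → W 0ᵥ → ∀ I (a : Fin d → Vec m) →
             (∀ j → j ∉ I → W (a j)) → ∀ j → W (zeroOn I a j)
  zeroOn-∈ 0∈W I a a∈W j with j ∈? I
  ... | yes _   = 0∈W
  ... | no j∉I = a∈W j j∉I

  translate-isMDS : ∀ {w b d m} {t} {W : Vec m → Set w} {T : (Fin d → Vec m) → Set b} →
                    (∀ {x y} → x ≈ᵥ y → W x → W y) → (u : Fin d → Vec m) →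
                    IsMDS _≈ᵥ_ d t (λ _ → W) T → IsMDS _≈ᵥ_ d t (λ i → Coset W (u i)) (Translate u T)
  translate-isMDS {d = d} {m} {W = W} {T} W-resp u T-mds I ∣I∣≡t a a∈u+W = existence , uniqueness
    where
    a-u : Fin d → Vec m
    a-u j = a j -ᵥ u j

    shifted-unique : ∀ Z Z′ → InProduct (λ _ → W) Z × T Z × InPlane _≈ᵥ_ I a-u Z →
                     InProduct (λ _ → W) Z′ × T Z′ × InPlane _≈ᵥ_ I a-u Z′ → ∀ i → Z i ≈ᵥ Z′ i
    shifted-unique = proj₂ (T-mds I ∣I∣≡t a-u a∈u+W)

    shiftBack : ∀ {Y} → InProduct (λ i → Coset W (u i)) Y → InPlane _≈ᵥ_ I a Y → ((Z , _) : Translate u T Y) →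
                InProduct (λ _ → W) Z × T Z × InPlane _≈ᵥ_ I a-u Z
    shiftBack {Y} Y∈u+W Y∈Γ (Z , TZ , Y≈u+Z) = Z∈W , TZ , Z∈Γ
      where
      Z≈Y-u : ∀ i → Z i ≈ᵥ (Y i -ᵥ u i)
      Z≈Y-u i l = x≈y+z⇒z≈x-y (Y≈u+Z i l)
      Z∈W : InProduct (λ _ → W) Z
      Z∈W i = W-resp (λ l → ≈-sym (Z≈Y-u i l)) (Y∈u+W i)
      Z∈Γ : InPlane _≈ᵥ_ I a-u Z
      Z∈Γ j j∉I l = trans (Z≈Y-u j l) (+-congʳ (Y∈Γ j j∉I l))

    existence : ∃ λ Y → InProduct (λ i → Coset W (u i)) Y × Translate u T Y × InPlane _≈ᵥ_ I a Y
    existence with proj₁ (T-mds I ∣I∣≡t a-u a∈u+W)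
    ... | Z , Z∈W , TZ , Z∈Γ = (λ j → u j +ᵥ Z j) , Y∈u+W , (Z , TZ , λ _ _ → ≈-refl) , Y∈Γ
      where
      Y∈u+W : InProduct (λ i → Coset W (u i)) (λ j → u j +ᵥ Z j)
      Y∈u+W i = W-resp (λ l → x≈y+z⇒z≈x-y ≈-refl) (Z∈W i)
      Y∈Γ : InPlane _≈ᵥ_ I a (λ j → u j +ᵥ Z j)
      Y∈Γ j j∉I l = trans (+-congˡ (Z∈Γ j j∉I l)) (y+[x-y]≈x (a j l) (u j l))

    uniqueness : ∀ Y Y′ → InProduct (λ i → Coset W (u i)) Y × Translate u T Y × InPlane _≈ᵥ_ I a Y →
                 InProduct (λ i → Coset W (u i)) Y′ × Translate u T Y′ × InPlane _≈ᵥ_ I a Y′ →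
                 ∀ i → Y i ≈ᵥ Y′ i
    uniqueness Y Y′ (Y∈u+W , Y∈T@(Z , _ , Y≈u+Z) , Y∈Γ) (Y′∈u+W , Y′∈T@(Z′ , _ , Y′≈u+Z′) , Y′∈Γ) i l = begin
      Y i l          ≈⟨ Y≈u+Z i l ⟩
      u i l + Z i l  ≈⟨ +-congˡ (shifted-unique Z Z′ (shiftBack Y∈u+W Y∈Γ Y∈T) (shiftBack Y′∈u+W Y′∈Γ Y′∈T) i l) ⟩
      u i l + Z′ i l ≈⟨ Y′≈u+Z′ i l ⟨
      Y′ i l         ∎

  translate-kernelIn-⇔ : ∀ {r d m} (A : Mat r d) {W : Vec m → Set ℓ} → IsSubspace W →
                         (u : Fin d → Vec m) → CheckZeroMat A u → ∀ Y →
                         Translate u (KernelIn W A) Y ⇔ (CheckZeroMat A Y × InProduct (λ i → Coset W (u i)) Y)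
  translate-kernelIn-⇔ A {W} W-sub u Au≈0 Y = mk⇔ to from
    where
    open IsSubspace W-sub using (resp)
    to : Translate u (KernelIn W A) Y → CheckZeroMat A Y × InProduct (λ i → Coset W (u i)) Y
    to (Z , (Z∈W , AZ≈0) , Y≈u+Z) =
      checkZeroMat-resp A (λ j l → ≈-sym (Y≈u+Z j l)) (checkZeroMat-+ A Au≈0 AZ≈0) ,
      λ i → resp (λ l → x≈y+z⇒z≈x-y (Y≈u+Z i l)) (Z∈W i)
    from : CheckZeroMat A Y × InProduct (λ i → Coset W (u i)) Y → Translate u (KernelIn W A) Y
    from (AY≈0 , Y∈u+W) =
      (λ j → Y j -ᵥ u j) , (Y∈u+W , checkZeroMat-‿ A AY≈0 Au≈0) , λ j l → ≈-sym (y+[x-y]≈x (Y j l) (u j l))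

  module _ {r d t} (A : Mat r d) (C-mds : IsMDS _≈_ d t (λ _ _ → Level.Lift ℓ ⊤) (CheckZero A)) where

    systematicCodeword : ∀ I → ∣ I ∣ ≡ t → (j : Fin d) →
                         ∃ λ e → CheckZero A e × (∀ i → i ∉ I → e i ≈ δ j i)
    systematicCodeword I ∣I∣≡t j with proj₁ (C-mds I ∣I∣≡t (δ j) (λ _ _ → lift tt))
    ... | e , _ , Ae≈0 , e≈δ = e , Ae≈0 , e≈δ

    kernelIn-interpolate : ∀ {m} {W : Vec m → Set ℓ} → IsSubspace W → ∀ I → ∣ I ∣ ≡ t →
                           (b : Fin d → Vec m) → (∀ j → W (b j)) →
                           ∃ λ X → KernelIn W A X × (∀ i → i ∉ I → X i ≈ᵥ b i)
    kernelIn-interpolate {m} {W} W-sub I ∣I∣≡t b b∈W = X , (X∈W , checkZeroMat-combination A e b Ae≈0) , X≈b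
      where
      e : Fin d → Vec d
      e j = proj₁ (systematicCodeword I ∣I∣≡t j)
      Ae≈0 : ∀ j → CheckZero A (e j)
      Ae≈0 j = proj₁ (proj₂ (systematicCodeword I ∣I∣≡t j))
      X : Fin d → Vec m
      X i l = sum (λ j → e j i * b j l)
      X∈W : ∀ i → W (X i)
      X∈W i = ∈-linearCombination W-sub (λ j → e j i) b b∈W
      X≈b : ∀ i → i ∉ I → X i ≈ᵥ b i
      X≈b i i∉I l = sum-δ e (λ j → b j l) i (λ j → proj₂ (proj₂ (systematicCodeword I ∣I∣≡t j)) i i∉I)

    checkZeroMat-unique : ∀ {m} I → ∣ I ∣ ≡ t → (a : Fin d → Vec m) {X Y : Fin d → Vec m} →
                          CheckZeroMat A X × InPlane _≈ᵥ_ I a X → CheckZeroMat A Y × InPlane _≈ᵥ_ I a Y →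
                          ∀ i → X i ≈ᵥ Y i
    checkZeroMat-unique I ∣I∣≡t a {X} {Y} (AX≈0 , X∈Γ) (AY≈0 , Y∈Γ) i l =
      proj₂ (C-mds I ∣I∣≡t (λ j → a j l) (λ _ _ → lift tt)) (λ j → X j l) (λ j → Y j l)
        ((λ _ → lift tt) , (λ k → AX≈0 k l) , (λ j j∉I → X∈Γ j j∉I l))
        ((λ _ → lift tt) , (λ k → AY≈0 k l) , (λ j j∉I → Y∈Γ j j∉I l)) i

    kernelIn-isMDS : ∀ {m} {W : Vec m → Set ℓ} → IsSubspace W → IsMDS _≈ᵥ_ d t (λ _ → W) (KernelIn W A)
    kernelIn-isMDS {W = W} W-sub I ∣I∣≡t a a∈W = existence , uniqueness
      where
      existence : ∃ λ X → InProduct (λ _ → W) X × KernelIn W A X × InPlane _≈ᵥ_ I a X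
      existence with kernelIn-interpolate W-sub I ∣I∣≡t (zeroOn I a) (zeroOn-∈ {W = W} (IsSubspace.zero∈ W-sub) I a a∈W)
      ... | X , (X∈W , AX≈0) , X≈b = X , X∈W , (X∈W , AX≈0) , λ j j∉I l → trans (X≈b j j∉I l) (zeroOn-∉ I a j∉I l)
      uniqueness : ∀ X Y → InProduct (λ _ → W) X × KernelIn W A X × InPlane _≈ᵥ_ I a X →
                   InProduct (λ _ → W) Y × KernelIn W A Y × InPlane _≈ᵥ_ I a Y → ∀ i → X i ≈ᵥ Y i
      uniqueness X Y (_ , (_ , AX≈0) , X∈Γ) (_ , (_ , AY≈0) , Y∈Γ) =
        checkZeroMat-unique I ∣I∣≡t a (AX≈0 , X∈Γ) (AY≈0 , Y∈Γ)

proposition9 : ∀ {c ℓ} (F : CommutativeRing c ℓ) (p : ℕ) → IsPrimePower p → IsGF F p →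
    (m d t r : ℕ) → 1 ≤ m → 1 ≤ d →
    (A : LinAlg.Mat F r d) →
    IsMDS (CommutativeRing._≈_ F) d t (λ _ _ → Level.Lift ℓ ⊤) (LinAlg.CheckZero F A) →
    (W : LinAlg.Vec F m → Set ℓ) → LinAlg.IsSubspace F W →
    (u : Fin d → LinAlg.Vec F m) → LinAlg.CheckZeroMat F A u →
    let open LinAlg F
        MuW : (Fin d → Vec m) → Set (c Level.⊔ ℓ)
        MuW Y = ∃ λ Z → ((∀ j → W (Z j)) × CheckZeroMat A Z) × (∀ j → Y j ≈ᵥ (u j +ᵥ Z j))
        Alph : Fin d → Vec m → Set ℓ
        Alph i v = W (v -ᵥ u i)
    in IsMDS _≈ᵥ_ d t Alph MuW
       × (∀ Y → MuW Y ⇔ (CheckZeroMat A Y × InProduct Alph Y))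
proposition9 F _ _ _ m d t r _ _ A C-mds W W-sub u Au≈0 =
  translate-isMDS F (IsSubspace.resp W-sub) u (kernelIn-isMDS F A C-mds W-sub) ,
  translate-kernelIn-⇔ F A W-sub u Au≈0
  where open LinAlg F using (IsSubspace)
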